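{- Let $n\ge 2$ and $t\ge 1$ be integers. Then $f_t(M(C_{2n}))\le t2^{n+1}+2n-2$.
   Context: A pebbling move removes two pebbles from a vertex and places one pebble on an adjacent vertex. The $t$-pebbling number $f_t(G)$ of a graph $G$ is the smallest integer $N$ such that from every distribution of $N$ pebbles on the vertices of $G$, it is possible to move $t$ pebbles to any (arbitrarily chosen) vertex by a sequence of pebbling moves. $C_{2n}$ is the cycle on $2n$ vertices. The middle graph $M(G)$ is obtained from $G$ by inserting a new vertex into each edge of $G$ (subdividing it) and joining two new vertices by an edge whenever the corresponding edges of $G$ share an endpoint. -}

module Defs where

open import Data.Nat using (ℕ; zero; suc; _+_; _*_; _∸_; _^_; _≤_; NonZero)
open import Data.Nat.DivMod using (_%_; m%n<n)
open import Data.Fin as Fin using (Fin; toℕ; fromℕ<; splitAt; _≟_)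
open import Data.List using (List; map; allFin)
open import Data.Nat.ListAction using (sum)
open import Data.Sum using (_⊎_; inj₁; inj₂)
open import Data.Product using (_×_; proj₁; proj₂; Σ; ∃; _,_)
open import Data.Empty using (⊥)
open import Relation.Nullary using (¬_; yes; no)
open import Relation.Binary.PropositionalEquality using (_≡_)
open import Relation.Binary.Construct.Closure.ReflexiveTransitive using (Star)

record Graph : Set₁ where
  field
    ord : ℕ
    Adj : Fin ord → Fin ord → Set

record EdgeGraph : Set where
  field
    ord  : ℕ
    size : ℕ
    ends : Fin size → Fin ord × Fin ord

IsEnd : (G : EdgeGraph) → Fin (EdgeGraph.ord G) → Fin (EdgeGraph.size G) → Set
IsEnd G v e = (v ≡ proj₁ (EdgeGraph.ends G e)) ⊎ (v ≡ proj₂ (EdgeGraph.ends G e))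

ShareEnd : (G : EdgeGraph) → Fin (EdgeGraph.size G) → Fin (EdgeGraph.size G) → Set
ShareEnd G e e' = Σ (Fin (EdgeGraph.ord G)) λ v → IsEnd G v e × IsEnd G v e'

-- Adjacency of the middle graph on the vertex set V(G) ⊎ E(G):
-- v ~ e when v is an endpoint of e (subdivision edges), and
-- e ~ e' when e ≠ e' share an endpoint.  Original edges of G are gone.
MAdj : (G : EdgeGraph) →
       Fin (EdgeGraph.ord G) ⊎ Fin (EdgeGraph.size G) →
       Fin (EdgeGraph.ord G) ⊎ Fin (EdgeGraph.size G) → Set
MAdj G (inj₁ v) (inj₁ w) = ⊥
MAdj G (inj₁ v) (inj₂ e) = IsEnd G v e
MAdj G (inj₂ e) (inj₁ v) = IsEnd G v e
MAdj G (inj₂ e) (inj₂ e') = ¬ (e ≡ e') × ShareEnd G e e'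

Middle : EdgeGraph → Graph
Middle G = record
  { ord = EdgeGraph.ord G + EdgeGraph.size G
  ; Adj = λ x y → MAdj G (splitAt (EdgeGraph.ord G) x) (splitAt (EdgeGraph.ord G) y)
  }

-- The cycle C_m (m ≥ 1) on vertices 0..m-1, edge i = {i, i+1 mod m}.
cycleNext : (m : ℕ) → Fin m → Fin m
cycleNext (suc p) i = fromℕ< (m%n<n (suc (toℕ i)) (suc p))

Cycle : (m : ℕ) → EdgeGraph
Cycle m = record { ord = m ; size = m ; ends = λ i → (i , cycleNext m i) }

Distribution : Graph → Set
Distribution G = Fin (Graph.ord G) → ℕ

∣_∣ᴰ : {G : Graph} → Distribution G → ℕ
∣_∣ᴰ {G} D = sum (map D (allFin (Graph.ord G)))

move : {G : Graph} → Distribution G → Fin (Graph.ord G) → Fin (Graph.ord G) → Distribution G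
move D u v w with w ≟ u | w ≟ v
... | yes _ | yes _ = D w ∸ 2 + 1
... | yes _ | no  _ = D w ∸ 2
... | no  _ | yes _ = D w + 1
... | no  _ | no  _ = D w

data Step (G : Graph) (D : Distribution G) : Distribution G → Set where
  pebble : (u v : Fin (Graph.ord G)) → Graph.Adj G u v → 2 ≤ D u →
           Step G D (move {G} D u v)

Reach : (G : Graph) → Distribution G → Distribution G → Set
Reach G = Star (Step G)

Solvable : (G : Graph) → ℕ → Distribution G → Fin (Graph.ord G) → Set
Solvable G t D r = Σ (Distribution G) λ D' → Reach G D D' × t ≤ D' r

Suffices : (G : Graph) → ℕ → ℕ → Set
Suffices G t N = (D : Distribution G) → ∣_∣ᴰ {G} D ≡ N →
                 (r : Fin (Graph.ord G)) → Solvable G t D r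

-- f_t(G) ≤ B  (f_t(G) is the least N with Suffices G t N)
PebblingAtMost : (G : Graph) → ℕ → ℕ → Set
PebblingAtMost G t B = ∃ λ N → N ≤ B × Suffices G t N

-- Fix a target r. Apart from r and the vertex opposite to it (the
-- antipode), M(C_2n) consists of two arms running into r: paths of
-- subdivision vertices, each carrying one vertex of C_2n as a leaf
-- (when r is itself a subdivision vertex, its two neighbours in C_2n
-- simply send half their piles to r). Collecting an arm of length L
-- greedily, far end first, delivers ⌊W / 2^L⌋ pebbles to r, where W
-- weights the pile at distance j from r by 2^(L - j). The antipode touches
-- the far ends of both arms, so its pile can be shared between them at
-- will. With t·2^(n+1) + 2n − 2 pebbles the total weight is large enough
-- that a suitable sharing makes the two floors add up to t.

module Submission where

open import Defs
open import Data.Nat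
  using (ℕ; zero; suc; _+_; _*_; _∸_; _^_; _≤_; _<_; _/_; _%_; NonZero; >-nonZero;
         z≤n; s≤s; z<s; s≤s⁻¹; _≤?_; _<?_)
open import Data.Nat.Properties
open import Data.Nat.DivMod
  using (m≡m%n+[m/n]*n; m%n<n; m%n≤n; m/n*n≤m; m*n/n≡m; /-monoˡ-≤; /-congʳ;
         +-distrib-/-∣ˡ; +-distrib-/-∣ʳ; m<n⇒m/n≡0; m/n/o≡m/[n*o];
         m<n⇒m%n≡m; %-distribˡ-+; m%n%n≡m%n; [m+n]%n≡m%n; m≤n⇒[n∸m]%m≡n%m)
open import Data.Nat.Divisibility using (_∣_; divides)
open import Data.Nat.Tactic.RingSolver using (solve-∀)
open import Algebra.Properties.CommutativeSemigroup +-commutativeSemigroup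
  using (interchange; xy∙z≈xz∙y; xy∙z≈y∙xz)
open import Data.Product using (∃-syntax; _×_; _,_; proj₁; proj₂)
open import Data.Fin as Fin using (Fin; toℕ; _↑ˡ_; _↑ʳ_; splitAt)
open import Data.Fin.Properties
  using (toℕ-injective; toℕ<n; toℕ-fromℕ<; ↑ˡ-injective; ↑ʳ-injective;
         splitAt-↑ˡ; splitAt-↑ʳ; splitAt⁻¹-↑ˡ; splitAt⁻¹-↑ʳ)
open import Data.Sum using (inj₁; inj₂)
open import Data.Empty using (⊥)
open import Data.List using (tabulate; map; allFin)
open import Data.List.Properties using (map-tabulate)
open import Data.Nat.ListAction using (sum)
open import Function using (_∘_; id)
open import Relation.Binary.PropositionalEquality
open import Relation.Nullary using (¬_; yes; no; contradiction)
open import Relation.Binary.Construct.Closure.ReflexiveTransitive using (ε; _◅_; _◅◅_)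

pebbling-bound : ℕ → ℕ → ℕ
pebbling-bound n t = t * 2 ^ (n + 1) + 2 * n ∸ 2

pebbling-bound-suc : ∀ k t → pebbling-bound (suc k) t ≡ 2 * t * 2 ^ suc k + 2 * k
pebbling-bound-suc k t = begin
  t * 2 ^ (suc k + 1) + 2 * suc k ∸ 2      ≡⟨ cong (λ e → t * 2 ^ e + 2 * suc k ∸ 2) (+-comm (suc k) 1) ⟩
  t * (2 * 2 ^ suc k) + 2 * suc k ∸ 2      ≡⟨ cong (_∸ 2) (by-ring t (2 ^ suc k) k) ⟩
  2 * t * 2 ^ suc k + 2 * k + 2 ∸ 2        ≡⟨ m+n∸n≡m _ 2 ⟩
  2 * t * 2 ^ suc k + 2 * k                ∎
  where
  open ≡-Reasoning
  by-ring : ∀ t p k → t * (2 * p) + 2 * suc k ≡ 2 * t * p + 2 * k + 2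
  by-ring = solve-∀

-- Halving and the balanced split of the antipodal pile

m≤2*[m/2]+1 : ∀ m → m ≤ 2 * (m / 2) + 1
m≤2*[m/2]+1 m = begin
  m                  ≡⟨ m≡m%n+[m/n]*n m 2 ⟩
  m % 2 + m / 2 * 2  ≤⟨ +-monoˡ-≤ (m / 2 * 2) (s≤s⁻¹ (m%n<n m 2)) ⟩
  1 + m / 2 * 2      ≡⟨ trans (+-comm 1 _) (cong (_+ 1) (*-comm (m / 2) 2)) ⟩
  2 * (m / 2) + 1    ∎
  where open ≤-Reasoning

2*[m/2]≤m : ∀ m → 2 * (m / 2) ≤ m
2*[m/2]≤m m = subst (_≤ m) (*-comm (m / 2) 2) (m/n*n≤m m 2)

2*[a+[m/2∸a]]≤m : ∀ {a} m → a ≤ m / 2 → 2 * (a + (m / 2 ∸ a)) ≤ m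
2*[a+[m/2∸a]]≤m m a≤m/2 = subst (λ x → 2 * x ≤ m) (sym (m+[n∸m]≡n a≤m/2)) (2*[m/2]≤m m)

2*m≤2*n+1⇒m≤n : ∀ {m n} → 2 * m ≤ 2 * n + 1 → m ≤ n
2*m≤2*n+1⇒m≤n {m} {n} h =
  s≤s⁻¹ (*-cancelˡ-< 2 m (suc n) (≤-trans (s≤s h) (≤-reflexive (double-suc n))))
  where
  double-suc : ∀ n → suc (2 * n + 1) ≡ 2 * suc n
  double-suc = solve-∀

m*n≤o⇒m≤o/n : ∀ m {n o} .{{_ : NonZero n}} → m * n ≤ o → m ≤ o / n
m*n≤o⇒m≤o/n m {n} {o} h = subst (_≤ o / n) (m*n/n≡m m n) (/-monoˡ-≤ n h)

n∣m+[n∸m%n] : ∀ A M .{{_ : NonZero M}} → M ∣ A + (M ∸ A % M)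
n∣m+[n∸m%n] A M = divides (suc (A / M)) (begin
  A + (M ∸ A % M)                  ≡⟨ cong (_+ (M ∸ A % M)) (m≡m%n+[m/n]*n A M) ⟩
  A % M + A / M * M + (M ∸ A % M)  ≡⟨ xy∙z≈y∙xz (A % M) (A / M * M) (M ∸ A % M) ⟩
  A / M * M + (A % M + (M ∸ A % M)) ≡⟨ cong (A / M * M +_) (m+[n∸m]≡n (m%n≤n A M)) ⟩
  A / M * M + M                    ≡⟨ +-comm (A / M * M) M ⟩
  suc (A / M) * M                  ∎)
  where open ≡-Reasoning

-- If topping up A to a multiple of M costs at most P, spending the rest
-- of P on B loses nothing: both floors then add up to ⌊(A + B + P)/M⌋.
top-up-first : ∀ M .{{_ : NonZero M}} T A B P → M ∸ A % M ≤ P → T * M ≤ A + B + P →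
               T ≤ (A + (M ∸ A % M)) / M + (B + (P ∸ (M ∸ A % M))) / M
top-up-first M T A B P r≤P TM≤ = begin
  T                                    ≤⟨ m*n≤o⇒m≤o/n T TM≤ ⟩
  (A + B + P) / M                      ≡⟨ cong (_/ M) regroup ⟨
  (A + r + (B + (P ∸ r))) / M          ≡⟨ +-distrib-/-∣ˡ (B + (P ∸ r)) (n∣m+[n∸m%n] A M) ⟩
  (A + r) / M + (B + (P ∸ r)) / M      ∎
  where
  open ≤-Reasoning
  r = M ∸ A % M
  regroup : A + r + (B + (P ∸ r)) ≡ A + B + P
  regroup = begin-equality
    A + r + (B + (P ∸ r))  ≡⟨ interchange A r B (P ∸ r) ⟩
    A + B + (r + (P ∸ r))  ≡⟨ cong (A + B +_) (m+[n∸m]≡n r≤P) ⟩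
    A + B + P              ∎

-- If neither pile can be topped up from P, the remainders are so small
-- that the floors lose nothing when all of P goes to A.
no-top-up : ∀ M .{{_ : NonZero M}} T A B P → A % M + P < M → B % M + P < M →
            suc T * M ≤ A + B + 2 * P + 1 → T ≤ (A + P) / M + (B + (P ∸ P)) / M
no-top-up M T A B P A-fits B-fits [1+T]M≤ = begin
  T                               ≤⟨ s≤s⁻¹ (s≤s⁻¹ (*-cancelʳ-< M (suc T) (2 + (A / M + B / M)) (≤-<-trans [1+T]M≤ total<))) ⟩
  A / M + B / M                   ≡⟨ cong₂ _+_ low-rest (cong (_/ M) (+-identityʳ B)) ⟨
  (A + P) / M + (B + 0) / M       ≡⟨ cong (λ x → (A + P) / M + (B + x) / M) (n∸n≡0 P) ⟨
  (A + P) / M + (B + (P ∸ P)) / M ∎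
  where
  open ≤-Reasoning
  low-rest : (A + P) / M ≡ A / M
  low-rest = begin-equality
    (A + P) / M                       ≡⟨ cong (λ y → (y + P) / M) (m≡m%n+[m/n]*n A M) ⟩
    (A % M + A / M * M + P) / M       ≡⟨ cong (_/ M) (xy∙z≈xz∙y (A % M) _ P) ⟩
    (A % M + P + A / M * M) / M       ≡⟨ +-distrib-/-∣ʳ (A % M + P) (divides (A / M) refl) ⟩
    (A % M + P) / M + A / M * M / M   ≡⟨ cong₂ _+_ (m<n⇒m/n≡0 A-fits) (m*n/n≡m (A / M) M) ⟩
    A / M                             ∎
  total< : A + B + 2 * P + 1 < (2 + (A / M + B / M)) * M
  total< = begin-strict
    A + B + 2 * P + 1
      ≡⟨ cong₂ (λ x y → x + y + 2 * P + 1) (m≡m%n+[m/n]*n A M) (m≡m%n+[m/n]*n B M) ⟩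
    (A % M + A / M * M) + (B % M + B / M * M) + 2 * P + 1
      ≡⟨ by-ring (A % M) (A / M) (B % M) (B / M) P M ⟩
    (A % M + P) + suc (B % M + P) + (A / M + B / M) * M
      <⟨ +-monoˡ-< _ (+-mono-<-≤ A-fits B-fits) ⟩
    M + M + (A / M + B / M) * M
      ≡⟨ by-ring′ M (A / M) (B / M) ⟩
    (2 + (A / M + B / M)) * M ∎
    where
    by-ring : ∀ sA qA sB qB P M → (sA + qA * M) + (sB + qB * M) + 2 * P + 1 ≡ (sA + P) + suc (sB + P) + (qA + qB) * M
    by-ring = solve-∀
    by-ring′ : ∀ M qA qB → M + M + (qA + qB) * M ≡ (2 + (qA + qB)) * M
    by-ring′ = solve-∀

balance-floors : ∀ M .{{_ : NonZero M}} T A B P →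
                 T * M ≤ A + B + P → suc T * M ≤ A + B + 2 * P + 1 →
                 ∃[ a ] a ≤ P × T ≤ (A + a) / M + (B + (P ∸ a)) / M
balance-floors M T A B P h₁ h₂ with M ∸ A % M ≤? P | M ∸ B % M ≤? P
... | yes fillA | _ = _ , fillA , top-up-first M T A B P fillA h₁
... | no _ | yes fillB = P ∸ r , m∸n≤m P r , (begin
  T                                          ≤⟨ top-up-first M T B A P fillB (≤-trans h₁ (≤-reflexive (cong (_+ P) (+-comm A B)))) ⟩
  (B + r) / M + (A + (P ∸ r)) / M            ≡⟨ +-comm ((B + r) / M) _ ⟩
  (A + (P ∸ r)) / M + (B + r) / M            ≡⟨ cong (λ x → (A + (P ∸ r)) / M + (B + x) / M) (m∸[m∸n]≡n fillB) ⟨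
  (A + (P ∸ r)) / M + (B + (P ∸ (P ∸ r))) / M ∎)
  where
  open ≤-Reasoning
  r = M ∸ B % M
... | no ¬fillA | no ¬fillB = P , ≤-refl , no-top-up M T A B P (fits A ¬fillA) (fits B ¬fillB) h₂
  where
  fits : ∀ X → ¬ (M ∸ X % M ≤ P) → X % M + P < M
  fits X ¬fill = subst (X % M + P <_) (m+[n∸m]≡n (m%n≤n X M)) (+-monoʳ-< (X % M) (≰⇒> ¬fill))

balanced-split : ∀ M .{{_ : NonZero M}} c t A B P →
                 2 * t * M ≤ c + (A + B + 2 * P + 1) →
                 ∃[ a ] a ≤ P × t ≤ c + ((A + a) / M + (B + (P ∸ a)) / M)
balanced-split M c t A B P h with t ≤? c
... | yes t≤c = 0 , z≤n , ≤-trans t≤c (m≤m+n c _)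
... | no t≰c =
  let a , a≤P , T≤ = balance-floors M T A B P TM≤ [1+T]M≤ in
  a , a≤P , ≤-trans (≤-reflexive t≡c+T) (+-monoʳ-≤ c T≤)
  where
  open ≤-Reasoning
  T = t ∸ c
  c≤t = <⇒≤ (≰⇒> t≰c)
  t≡c+T : t ≡ c + T
  t≡c+T = sym (m+[n∸m]≡n c≤t)
  M≤TM : M ≤ T * M
  M≤TM = m≤n*m M T {{>-nonZero (m<n⇒0<n∸m (≰⇒> t≰c))}}
  c≤2cM : c ≤ 2 * c * M
  c≤2cM = ≤-trans (m≤m*n c M) (*-monoˡ-≤ M (m≤n*m c 2))
  2TM≤ : 2 * T * M ≤ A + B + 2 * P + 1
  2TM≤ = +-cancelˡ-≤ c _ _ (begin
    c + 2 * T * M          ≤⟨ +-monoˡ-≤ _ c≤2cM ⟩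
    2 * c * M + 2 * T * M  ≡⟨ by-ring c T M ⟩
    2 * (c + T) * M        ≡⟨ cong (λ x → 2 * x * M) t≡c+T ⟨
    2 * t * M              ≤⟨ h ⟩
    c + (A + B + 2 * P + 1) ∎)
    where
    by-ring : ∀ c T M → 2 * c * M + 2 * T * M ≡ 2 * (c + T) * M
    by-ring = solve-∀
  TM≤ : T * M ≤ A + B + P
  TM≤ = 2*m≤2*n+1⇒m≤n (begin
    2 * (T * M)            ≡⟨ *-assoc 2 T M ⟨
    2 * T * M              ≤⟨ 2TM≤ ⟩
    A + B + 2 * P + 1      ≤⟨ +-monoˡ-≤ 1 (m≤m+n _ (A + B)) ⟩
    A + B + 2 * P + (A + B) + 1 ≡⟨ by-ring A B P ⟩
    2 * (A + B + P) + 1    ∎)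
    where
    by-ring : ∀ A B P → A + B + 2 * P + (A + B) + 1 ≡ 2 * (A + B + P) + 1
    by-ring = solve-∀
  [1+T]M≤ : suc T * M ≤ A + B + 2 * P + 1
  [1+T]M≤ = begin
    M + T * M              ≤⟨ +-monoˡ-≤ (T * M) M≤TM ⟩
    T * M + T * M          ≡⟨ by-ring T M ⟩
    2 * T * M              ≤⟨ 2TM≤ ⟩
    A + B + 2 * P + 1      ∎
    where
    by-ring : ∀ T M → T * M + T * M ≡ 2 * T * M
    by-ring = solve-∀

∑< : ℕ → (ℕ → ℕ) → ℕ
∑< zero    f = 0
∑< (suc n) f = f 0 + ∑< n (f ∘ suc)

syntax ∑< n (λ i → e) = ∑[ i < n ] e

∑-cong : ∀ n {f g : ℕ → ℕ} → (∀ {i} → i < n → f i ≡ g i) → ∑< n f ≡ ∑< n g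
∑-cong zero    eq = refl
∑-cong (suc n) eq = cong₂ _+_ (eq z<s) (∑-cong n (eq ∘ s≤s))

∑-last : ∀ n f → ∑< (suc n) f ≡ ∑< n f + f n
∑-last zero    f = +-comm (f 0) 0
∑-last (suc n) f = trans (cong (f 0 +_) (∑-last n (f ∘ suc))) (sym (+-assoc (f 0) _ _))

∑-+ : ∀ a b f → ∑< (a + b) f ≡ ∑< a f + ∑[ i < b ] f (a + i)
∑-+ zero    b f = refl
∑-+ (suc a) b f = trans (cong (f 0 +_) (∑-+ a b (f ∘ suc))) (sym (+-assoc (f 0) _ _))

∑-reverse : ∀ n f → ∑[ i < n ] f (n ∸ suc i) ≡ ∑< n f
∑-reverse zero    f = refl
∑-reverse (suc n) f = begin
  f n + ∑[ i < n ] f (n ∸ suc i)  ≡⟨ cong (f n +_) (∑-reverse n f) ⟩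
  f n + ∑< n f                    ≡⟨ +-comm (f n) _ ⟩
  ∑< n f + f n                    ≡⟨ ∑-last n f ⟨
  ∑< (suc n) f                    ∎
  where open ≡-Reasoning

∑-rotate : ∀ n f → (∀ i → f (i + n) ≡ f i) → ∀ s → ∑[ i < n ] f (s + i) ≡ ∑< n f
∑-rotate n f periodic zero    = refl
∑-rotate n f periodic (suc s) = trans shift (∑-rotate n f periodic s)
  where
  open ≡-Reasoning
  g : ℕ → ℕ
  g i = f (s + i)
  shift : ∑[ i < n ] f (suc s + i) ≡ ∑< n g
  shift = +-cancelʳ-≡ (g 0) _ _ (begin
    ∑[ i < n ] f (suc s + i) + g 0  ≡⟨ cong (_+ g 0) (∑-cong n (λ {i} _ → cong f (sym (+-suc s i)))) ⟩
    ∑< n (g ∘ suc) + g 0            ≡⟨ +-comm _ (g 0) ⟩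
    ∑< (suc n) g                    ≡⟨ ∑-last n g ⟩
    ∑< n g + f (s + n)              ≡⟨ cong (λ x → ∑< n g + x) (trans (periodic s) (cong f (sym (+-identityʳ s)))) ⟩
    ∑< n g + g 0                    ∎)

sum-tabulate : ∀ n (g : Fin n → ℕ) (h : ℕ → ℕ) → (∀ i → h (toℕ i) ≡ g i) →
               sum (tabulate g) ≡ ∑< n h
sum-tabulate zero    g h eq = refl
sum-tabulate (suc n) g h eq =
  cong₂ _+_ (sym (eq Fin.zero)) (sum-tabulate n (g ∘ Fin.suc) (h ∘ suc) (eq ∘ Fin.suc))

sum-tabulate-↑ : ∀ a b (g : Fin (a + b) → ℕ) →
                 sum (tabulate g) ≡ sum (tabulate (g ∘ (_↑ˡ b))) + sum (tabulate (g ∘ (a ↑ʳ_)))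
sum-tabulate-↑ zero    b g = refl
sum-tabulate-↑ (suc a) b g =
  trans (cong (g Fin.zero +_) (sum-tabulate-↑ a b (g ∘ Fin.suc))) (sym (+-assoc (g Fin.zero) _ _))

-- Pushing pebbles down a path

_/2^_ : ℕ → ℕ → ℕ
m /2^ L = (m / 2 ^ L) {{m^n≢0 2 L}}

-- c j is the pile at distance j + 1 from the end of a path of length L;
-- moving half of every pile one step on, far piles first, delivers
-- deliver L c pebbles to the end.
deliver : ℕ → (ℕ → ℕ) → ℕ
deliver zero    c = 0
deliver (suc L) c = (c 0 + deliver L (c ∘ suc)) / 2

weight : ℕ → (ℕ → ℕ) → ℕ
weight zero    c = 0
weight (suc L) c = c 0 * 2 ^ L + weight L (c ∘ suc)

deliver≡weight/2^L : ∀ L c → deliver L c ≡ weight L c /2^ L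
deliver≡weight/2^L zero    c = refl
deliver≡weight/2^L (suc L) c = begin
  (c 0 + deliver L (c ∘ suc)) / 2                      ≡⟨ cong (λ x → (c 0 + x) / 2) (deliver≡weight/2^L L (c ∘ suc)) ⟩
  (c 0 + W / 2 ^ L) / 2                                ≡⟨ cong (λ x → (x + W / 2 ^ L) / 2) (m*n/n≡m (c 0) (2 ^ L)) ⟨
  (c 0 * 2 ^ L / 2 ^ L + W / 2 ^ L) / 2                ≡⟨ cong (_/ 2) (+-distrib-/-∣ˡ W (divides (c 0) refl)) ⟨
  (c 0 * 2 ^ L + W) / 2 ^ L / 2                        ≡⟨ m/n/o≡m/[n*o] _ (2 ^ L) 2 ⟩
  (c 0 * 2 ^ L + W) / (2 ^ L * 2)                      ≡⟨ /-congʳ (*-comm (2 ^ L) 2) ⟩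
  (c 0 * 2 ^ L + W) / 2 ^ suc L                        ∎
  where
  open ≡-Reasoning
  W = weight L (c ∘ suc)
  instance
    2^L≢0 : NonZero (2 ^ L)
    2^L≢0 = m^n≢0 2 L
    2^L*2≢0 : NonZero (2 ^ L * 2)
    2^L*2≢0 = m*n≢0 (2 ^ L) 2
    2^[1+L]≢0 : NonZero (2 ^ suc L)
    2^[1+L]≢0 = m^n≢0 2 (suc L)

weight-last : ∀ L c → weight (suc L) c ≡ 2 * weight L c + c L
weight-last zero    c = trans (+-identityʳ (c 0 * 1)) (*-identityʳ (c 0))
weight-last (suc L) c = begin
  c 0 * 2 ^ suc L + weight (suc L) (c ∘ suc)          ≡⟨ cong (c 0 * 2 ^ suc L +_) (weight-last L (c ∘ suc)) ⟩
  c 0 * (2 * 2 ^ L) + (2 * weight L (c ∘ suc) + c (suc L)) ≡⟨ by-ring (c 0) (2 ^ L) (weight L (c ∘ suc)) (c (suc L)) ⟩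
  2 * (c 0 * 2 ^ L + weight L (c ∘ suc)) + c (suc L)  ∎
  where
  open ≡-Reasoning
  by-ring : ∀ a p w x → a * (2 * p) + (2 * w + x) ≡ 2 * (a * p + w) + x
  by-ring = solve-∀

weight-mono : ∀ L {c c′ : ℕ → ℕ} → (∀ {j} → j < L → c j ≤ c′ j) → weight L c ≤ weight L c′
weight-mono zero    le = z≤n
weight-mono (suc L) le = +-mono-≤ (*-monoˡ-≤ _ (le z<s)) (weight-mono L (le ∘ s≤s))

-- The far end of a path of length L + 1 has weight one: an extra a pebbles
-- there raise the weighted total by exactly a.
deliver-far-≥ : ∀ L (c c′ : ℕ → ℕ) y a → (∀ {j} → j < L → c j ≤ c′ j) → y + a ≤ c′ L →
                (2 * weight L c + y + a) /2^ suc L ≤ deliver (suc L) c′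
deliver-far-≥ L c c′ y a near far = begin
  (2 * weight L c + y + a) /2^ suc L      ≤⟨ /-monoˡ-≤ (2 ^ suc L) {{m^n≢0 2 (suc L)}} total ⟩
  weight (suc L) c′ /2^ suc L             ≡⟨ deliver≡weight/2^L (suc L) c′ ⟨
  deliver (suc L) c′                      ∎
  where
  open ≤-Reasoning
  total : 2 * weight L c + y + a ≤ weight (suc L) c′
  total = begin
    2 * weight L c + y + a       ≡⟨ +-assoc (2 * weight L c) y a ⟩
    2 * weight L c + (y + a)     ≤⟨ +-mono-≤ (*-monoʳ-≤ 2 (weight-mono L near)) far ⟩
    2 * weight L c′ + c′ L       ≡⟨ weight-last L c′ ⟨
    weight (suc L) c′            ∎

∑+∑≤2*weight+L : ∀ L (e f : ℕ → ℕ) → ∑< L e + ∑< L f ≤ 2 * weight L (λ j → e j + f j / 2) + L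
∑+∑≤2*weight+L zero    e f = z≤n
∑+∑≤2*weight+L (suc L) e f = begin
  e 0 + ∑< L (e ∘ suc) + (f 0 + ∑< L (f ∘ suc))    ≡⟨ interchange (e 0) _ (f 0) _ ⟩
  e 0 + f 0 + (∑< L (e ∘ suc) + ∑< L (f ∘ suc))    ≤⟨ +-mono-≤ head (∑+∑≤2*weight+L L (e ∘ suc) (f ∘ suc)) ⟩
  2 * c + 1 + (2 * W + L)                          ≤⟨ +-monoˡ-≤ (2 * W + L) (+-monoˡ-≤ 1 (*-monoʳ-≤ 2 (m≤m*n c (2 ^ L) {{m^n≢0 2 L}}))) ⟩
  2 * (c * 2 ^ L) + 1 + (2 * W + L)                ≡⟨ by-ring (c * 2 ^ L) W L ⟩
  2 * (c * 2 ^ L + W) + suc L                      ∎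
  where
  open ≤-Reasoning
  c = e 0 + f 0 / 2
  W = weight L (λ j → e (suc j) + f (suc j) / 2)
  head : e 0 + f 0 ≤ 2 * c + 1
  head = begin
    e 0 + f 0                     ≤⟨ +-mono-≤ (m≤m+n (e 0) (e 0 + 0)) (m≤2*[m/2]+1 (f 0)) ⟩
    2 * e 0 + (2 * (f 0 / 2) + 1) ≡⟨ by-ring′ (e 0) (f 0 / 2) ⟩
    2 * c + 1                     ∎
    where
    by-ring′ : ∀ a h → 2 * a + (2 * h + 1) ≡ 2 * (a + h) + 1
    by-ring′ = solve-∀
  by-ring : ∀ x w L → 2 * x + 1 + (2 * w + L) ≡ 2 * (x + w) + suc L
  by-ring = solve-∀

-- Pebbling strategies in a loopless graph

module Loopless (G : Graph) (Adj⇒≢ : ∀ {u v} → Graph.Adj G u v → u ≢ v) where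

  open Graph G using (Adj)

  Vertex : Set
  Vertex = Fin (Graph.ord G)

  move-source : ∀ (D : Distribution G) {u v} → u ≢ v → move {G} D u v u ≡ D u ∸ 2
  move-source D {u} {v} u≢v with u Fin.≟ u | u Fin.≟ v
  ... | yes _   | yes u≡v = contradiction u≡v u≢v
  ... | yes _   | no _    = refl
  ... | no u≢u  | _       = contradiction refl u≢u

  move-target : ∀ (D : Distribution G) {u v} → u ≢ v → move {G} D u v v ≡ D v + 1
  move-target D {u} {v} u≢v with v Fin.≟ u | v Fin.≟ v
  ... | yes v≡u | _       = contradiction (sym v≡u) u≢v
  ... | no _    | yes _   = refl
  ... | no _    | no v≢v  = contradiction refl v≢v

  move-elsewhere : ∀ (D : Distribution G) {u v w} → w ≢ u → D w ≤ move {G} D u v w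
  move-elsewhere D {u} {v} {w} w≢u with w Fin.≟ u | w Fin.≟ v
  ... | yes w≡u | _       = contradiction w≡u w≢u
  ... | no _    | yes _   = m≤m+n (D w) 1
  ... | no _    | no _    = ≤-refl

  record Transfer (D : Distribution G) (u v : Vertex) (k : ℕ) : Set where
    field
      result : Distribution G
      reach  : Reach G D result
      source : D u ∸ 2 * k ≤ result u
      target : D v + k ≤ result v
      frame  : ∀ {w} → w ≢ u → D w ≤ result w

  transfer : ∀ {u v} → Adj u v → ∀ k D → 2 * k ≤ D u → Transfer D u v k
  transfer adj zero D _ = record
    { result = D
    ; reach  = ε
    ; source = ≤-refl
    ; target = ≤-reflexive (+-identityʳ _)
    ; frame  = λ _ → ≤-refl
    }
  transfer {u} {v} adj (suc k) D 2k+2≤ = record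
    { result = T.result
    ; reach  = pebble u v adj 2≤ ◅ T.reach
    ; source = ≤-trans (≤-reflexive source-eq) T.source
    ; target = ≤-trans (≤-reflexive target-eq) T.target
    ; frame  = λ w≢u → ≤-trans (move-elsewhere D w≢u) (T.frame w≢u)
    }
    where
    u≢v = Adj⇒≢ adj
    D′ = move {G} D u v
    2≤ : 2 ≤ D u
    2≤ = ≤-trans (m≤m+n 2 (2 * k)) (≤-trans (≤-reflexive (sym (*-suc 2 k))) 2k+2≤)
    2k≤ : 2 * k ≤ D′ u
    2k≤ = begin
      2 * k              ≡⟨ m+n∸m≡n 2 (2 * k) ⟨
      2 + 2 * k ∸ 2      ≤⟨ ∸-monoˡ-≤ 2 (≤-trans (≤-reflexive (sym (*-suc 2 k))) 2k+2≤) ⟩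
      D u ∸ 2            ≡⟨ move-source D u≢v ⟨
      D′ u               ∎
      where open ≤-Reasoning
    module T = Transfer (transfer adj k D′ 2k≤)
    source-eq : D u ∸ 2 * suc k ≡ D′ u ∸ 2 * k
    source-eq = begin
      D u ∸ 2 * suc k    ≡⟨ cong (D u ∸_) (*-suc 2 k) ⟩
      D u ∸ (2 + 2 * k)  ≡⟨ ∸-+-assoc (D u) 2 (2 * k) ⟨
      D u ∸ 2 ∸ 2 * k    ≡⟨ cong (_∸ 2 * k) (move-source D u≢v) ⟨
      D′ u ∸ 2 * k       ∎
      where open ≡-Reasoning
    target-eq : D v + suc k ≡ D′ v + k
    target-eq = trans (+-suc (D v) k) (cong (_+ k) (trans (+-comm 1 (D v)) (sym (move-target D u≢v))))

  transfer-half : ∀ {u v} → Adj u v → ∀ D → Transfer D u v (D u / 2)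
  transfer-half {u} adj D = transfer adj (D u / 2) D (2*[m/2]≤m (D u))

  record Split (D : Distribution G) (s v w : Vertex) (a b : ℕ) : Set where
    field
      result : Distribution G
      reach  : Reach G D result
      left   : D v + a ≤ result v
      right  : D w + b ≤ result w
      frame  : ∀ {x} → x ≢ s → D x ≤ result x

  split : ∀ {s v w} → Adj s v → Adj s w → ∀ a b D → 2 * (a + b) ≤ D s → Split D s v w a b
  split {s} {v} {w} adj₁ adj₂ a b D 2[a+b]≤ = record
    { result = T₂.result
    ; reach  = T₁.reach ◅◅ T₂.reach
    ; left   = ≤-trans T₁.target (T₂.frame (≢-sym (Adj⇒≢ adj₁)))
    ; right  = ≤-trans (+-monoˡ-≤ b (T₁.frame (≢-sym (Adj⇒≢ adj₂)))) T₂.target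
    ; frame  = λ x≢s → ≤-trans (T₁.frame x≢s) (T₂.frame x≢s)
    }
    where
    2a+2b≤ : 2 * a + 2 * b ≤ D s
    2a+2b≤ = subst (_≤ D s) (*-distribˡ-+ 2 a b) 2[a+b]≤
    module T₁ = Transfer (transfer adj₁ a D (≤-trans (m≤m+n (2 * a) (2 * b)) 2a+2b≤))
    2b≤ : 2 * b ≤ T₁.result s
    2b≤ = ≤-trans (subst (_≤ D s ∸ 2 * a) (m+n∸m≡n (2 * a) (2 * b)) (∸-monoˡ-≤ (2 * a) 2a+2b≤)) T₁.source
    module T₂ = Transfer (transfer adj₂ b T₁.result 2b≤)

  record Gather (D : Distribution G) (u v r : Vertex) : Set where
    field
      result : Distribution G
      reach  : Reach G D result
      target : D r + D u / 2 + D v / 2 ≤ result r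
      frame  : ∀ {x} → x ≢ u → x ≢ v → D x ≤ result x

  gather : ∀ {u v r} → Adj u r → Adj v r → u ≢ v → ∀ D → Gather D u v r
  gather {u} {v} {r} adj₁ adj₂ u≢v D = record
    { result = T₂.result
    ; reach  = T₁.reach ◅◅ T₂.reach
    ; target = ≤-trans (+-mono-≤ T₁.target (/-monoˡ-≤ 2 (T₁.frame (≢-sym u≢v)))) T₂.target
    ; frame  = λ x≢u x≢v → ≤-trans (T₁.frame x≢u) (T₂.frame x≢v)
    }
    where
    module T₁ = Transfer (transfer-half adj₁ D)
    module T₂ = Transfer (transfer-half adj₂ T₁.result)

  -- A caterpillar hanging from root: the path spine (L - 1), …, spine 0, root,
  -- with leaf j attached to spine j.
  record Arm (root : Vertex) (L : ℕ) : Set where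
    field
      spine leaf      : ℕ → Vertex
      root-adj        : 0 < L → Adj (spine 0) root
      spine-adj       : ∀ {j} → suc j < L → Adj (spine (suc j)) (spine j)
      leaf-adj        : ∀ {j} → j < L → Adj (leaf j) (spine j)
      spine-injective : ∀ {i j} → i < L → j < L → spine i ≡ spine j → i ≡ j
      leaf-injective  : ∀ {i j} → i < L → j < L → leaf i ≡ leaf j → i ≡ j
      spine≢leaf      : ∀ {i j} → i < L → j < L → spine i ≢ leaf j
      root≢spine      : ∀ {j} → j < L → root ≢ spine j
      root≢leaf       : ∀ {j} → j < L → root ≢ leaf j

    value : Distribution G → ℕ → ℕ
    value D j = D (spine j) + D (leaf j) / 2

    Off : Vertex → Set
    Off w = ∀ {j} → j < L → w ≢ spine j × w ≢ leaf j

  shift : ∀ {r L} (A : Arm r (suc L)) → Arm (Arm.spine A 0) L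
  shift A = record
    { spine           = spine ∘ suc
    ; leaf            = leaf ∘ suc
    ; root-adj        = λ 0<L → spine-adj (s≤s 0<L)
    ; spine-adj       = spine-adj ∘ s≤s
    ; leaf-adj        = leaf-adj ∘ s≤s
    ; spine-injective = λ i< j< eq → suc-injective (spine-injective (s≤s i<) (s≤s j<) eq)
    ; leaf-injective  = λ i< j< eq → suc-injective (leaf-injective (s≤s i<) (s≤s j<) eq)
    ; spine≢leaf      = λ i< j< → spine≢leaf (s≤s i<) (s≤s j<)
    ; root≢spine      = λ j< eq → 0≢1+n (spine-injective z<s (s≤s j<) eq)
    ; root≢leaf       = λ j< → spine≢leaf z<s (s≤s j<)
    }
    where open Arm A

  record Collected {r L} (A : Arm r L) (D : Distribution G) : Set where
    open Arm A
    field
      result    : Distribution G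
      reach     : Reach G D result
      root-gain : D r + deliver L (value D) ≤ result r
      frame     : ∀ {w} → Off w → D w ≤ result w

  -- First collect the rest of the arm into spine 0, then add half of
  -- leaf 0, then push half of spine 0 onto the root.
  collect : ∀ {r L} (A : Arm r L) D → Collected A D
  collect {L = zero} A D = record
    { result    = D
    ; reach     = ε
    ; root-gain = ≤-reflexive (+-identityʳ _)
    ; frame     = λ _ → ≤-refl
    }
  collect {r} {suc L} A D = record
    { result    = T₃.result
    ; reach     = C₁.reach ◅◅ T₂.reach ◅◅ T₃.reach
    ; root-gain = ≤-trans (+-mono-≤ root-kept (/-monoˡ-≤ 2 spine₀-gain)) T₃.target
    ; frame     = λ off → ≤-trans (C₁.frame (off ∘ s≤s))
                            (≤-trans (T₂.frame (proj₂ (off z<s))) (T₃.frame (proj₁ (off z<s))))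
    }
    where
    open Arm A
    module C₁ = Collected (collect (shift A) D)
    module T₂ = Transfer (transfer-half (leaf-adj z<s) C₁.result)
    module T₃ = Transfer (transfer-half (root-adj z<s) T₂.result)
    root-off : Arm.Off (shift A) r
    root-off j< = root≢spine (s≤s j<) , root≢leaf (s≤s j<)
    leaf₀-off : Arm.Off (shift A) (leaf 0)
    leaf₀-off j< = ≢-sym (spine≢leaf (s≤s j<) z<s) , (λ eq → 0≢1+n (leaf-injective z<s (s≤s j<) eq))
    root-kept : D r ≤ T₂.result r
    root-kept = ≤-trans (C₁.frame root-off) (T₂.frame (root≢leaf z<s))
    spine₀-gain : value D 0 + deliver L (value D ∘ suc) ≤ T₂.result (spine 0)
    spine₀-gain = begin
      D (spine 0) + D (leaf 0) / 2 + deliver L (value D ∘ suc)  ≡⟨ xy∙z≈xz∙y (D (spine 0)) _ _ ⟩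
      D (spine 0) + deliver L (value D ∘ suc) + D (leaf 0) / 2  ≤⟨ +-mono-≤ C₁.root-gain (/-monoˡ-≤ 2 (C₁.frame leaf₀-off)) ⟩
      C₁.result (spine 0) + C₁.result (leaf 0) / 2              ≤⟨ T₂.target ⟩
      T₂.result (spine 0)                                       ∎
      where open ≤-Reasoning

  solvable-≤ : ∀ {t t′ D r} → t ≤ t′ → Solvable G t′ D r → Solvable G t D r
  solvable-≤ t≤t′ (D′ , reach , t′≤) = D′ , reach , ≤-trans t≤t′ t′≤

  reach-solvable : ∀ {t D D′ r} → Reach G D D′ → Solvable G t D′ r → Solvable G t D r
  reach-solvable D⇝D′ (D″ , D′⇝D″ , t≤) = D″ , D⇝D′ ◅◅ D′⇝D″ , t≤

  collect-two-arms : ∀ {r L L′} (F : Arm r L) (K : Arm r L′) D →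
                     Solvable G (D r + (deliver L (Arm.value F D)
                                 + deliver L′ (Arm.value K (Collected.result (collect F D)))))
                              D r
  collect-two-arms {r} {L} {L′} F K D = C₂.result , C₁.reach ◅◅ C₂.reach , (begin
    D r + (deliver L (value F D) + deliver L′ (value K C₁.result))  ≡⟨ +-assoc (D r) _ _ ⟨
    D r + deliver L (value F D) + deliver L′ (value K C₁.result)    ≤⟨ +-monoˡ-≤ _ C₁.root-gain ⟩
    C₁.result r + deliver L′ (value K C₁.result)                    ≤⟨ C₂.root-gain ⟩
    C₂.result r                                                     ∎)
    where
    open ≤-Reasoning
    open Arm using (value)
    module C₁ = Collected (collect F D)
    module C₂ = Collected (collect K C₁.result)

  solvable-by-split : ∀ L c t A B P {D r} → 2 * t * 2 ^ L ≤ c + (A + B + 2 * P + 1) →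
                      (∀ a → a ≤ P → Solvable G (c + ((A + a) /2^ L + (B + (P ∸ a)) /2^ L)) D r) →
                      Solvable G t D r
  solvable-by-split L c t A B P count run =
    let a , a≤P , t≤ = balanced-split (2 ^ L) {{m^n≢0 2 L}} c t A B P count in
    solvable-≤ t≤ (run a a≤P)

-- The middle graph of the cycle C_2n, n ≥ 2

module MiddleCycle (n₂ : ℕ) where

  n₁ n m : ℕ
  n₁ = suc n₂
  n  = suc n₁
  m  = 2 * n

  G : Graph
  G = Middle (Cycle m)

  open Graph G using (Adj)

  Vertex : Set
  Vertex = Fin (m + m)

  V E : Fin m → Vertex
  V i = i ↑ˡ m
  E i = m ↑ʳ i

  next : Fin m → Fin m
  next = cycleNext m

  V-injective : ∀ {i j} → V i ≡ V j → i ≡ j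
  V-injective = ↑ˡ-injective m _ _

  E-injective : ∀ {i j} → E i ≡ E j → i ≡ j
  E-injective = ↑ʳ-injective m _ _

  V≢E : ∀ {i j} → V i ≢ E j
  V≢E {i} {j} eq with () ← trans (sym (splitAt-↑ˡ m i m)) (trans (cong (splitAt m) eq) (splitAt-↑ʳ m m j))

  E≢V : ∀ {i j} → E i ≢ V j
  E≢V = ≢-sym V≢E

  Adj⇒≢ : ∀ {x y} → Adj x y → x ≢ y
  Adj⇒≢ {x} adj refl = loopless (splitAt m x) adj
    where
    loopless : ∀ s → MAdj (Cycle m) s s → ⊥
    loopless (inj₁ i) ()
    loopless (inj₂ e) (e≢e , _) = e≢e refl

  open Loopless G Adj⇒≢ hiding (Vertex)

  _⊕_ : Fin m → ℕ → Fin m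
  i ⊕ zero  = i
  i ⊕ suc k = next (i ⊕ k)

  toℕ-⊕ : ∀ i k → toℕ (i ⊕ k) ≡ (toℕ i + k) % m
  toℕ-⊕ i zero    = sym (trans (cong (_% m) (+-identityʳ (toℕ i))) (m<n⇒m%n≡m (toℕ<n i)))
  toℕ-⊕ i (suc k) = begin
    toℕ (next (i ⊕ k))                      ≡⟨ toℕ-fromℕ< _ ⟩
    (1 + toℕ (i ⊕ k)) % m                   ≡⟨ cong (λ x → (1 + x) % m) (toℕ-⊕ i k) ⟩
    (1 + (toℕ i + k) % m) % m               ≡⟨ %-distribˡ-+ 1 ((toℕ i + k) % m) m ⟩
    (1 % m + (toℕ i + k) % m % m) % m       ≡⟨ cong (λ x → (1 % m + x) % m) (m%n%n≡m%n (toℕ i + k) m) ⟩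
    (1 % m + (toℕ i + k) % m) % m           ≡⟨ %-distribˡ-+ 1 (toℕ i + k) m ⟨
    (1 + (toℕ i + k)) % m                   ≡⟨ cong (_% m) (sym (+-suc (toℕ i) k)) ⟩
    (toℕ i + suc k) % m                     ∎
    where open ≡-Reasoning

  ⊕-+ : ∀ i a b → i ⊕ (a + b) ≡ (i ⊕ a) ⊕ b
  ⊕-+ i a zero    = cong (i ⊕_) (+-identityʳ a)
  ⊕-+ i a (suc b) = trans (cong (i ⊕_) (+-suc a b)) (cong next (⊕-+ i a b))

  ⊕-period : ∀ i → i ⊕ m ≡ i
  ⊕-period i = toℕ-injective (begin
    toℕ (i ⊕ m)         ≡⟨ toℕ-⊕ i m ⟩
    (toℕ i + m) % m     ≡⟨ [m+n]%n≡m%n (toℕ i) m ⟩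
    toℕ i % m           ≡⟨ m<n⇒m%n≡m (toℕ<n i) ⟩
    toℕ i               ∎)
    where open ≡-Reasoning

  -- Going once around the cycle, (t + d) % m = t forces d = 0 or d = m.
  ⊕-fixed : ∀ i {d} → d < m → i ⊕ d ≡ i → d ≡ 0
  ⊕-fixed i {d} d<m eq with toℕ i + d <? m
  ... | yes t+d<m = +-cancelˡ-≡ (toℕ i) d 0 (begin
    toℕ i + d           ≡⟨ m<n⇒m%n≡m t+d<m ⟨
    (toℕ i + d) % m     ≡⟨ toℕ-⊕ i d ⟨
    toℕ (i ⊕ d)         ≡⟨ cong toℕ eq ⟩
    toℕ i               ≡⟨ +-identityʳ (toℕ i) ⟨
    toℕ i + 0           ∎)
    where open ≡-Reasoning
  ... | no t+d≮m = contradiction d≡m (<⇒≢ d<m)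
    where
    open ≡-Reasoning
    m≤t+d = ≮⇒≥ t+d≮m
    wrapped : toℕ i + d ∸ m < m
    wrapped = +-cancelʳ-< m _ m (subst (_< m + m) (sym (m∸n+n≡m m≤t+d)) (+-mono-< (toℕ<n i) d<m))
    d≡m : d ≡ m
    d≡m = +-cancelˡ-≡ (toℕ i) d m (begin
      toℕ i + d                 ≡⟨ m∸n+n≡m m≤t+d ⟨
      toℕ i + d ∸ m + m         ≡⟨ cong (_+ m) (m<n⇒m%n≡m wrapped) ⟨
      (toℕ i + d ∸ m) % m + m   ≡⟨ cong (_+ m) (m≤n⇒[n∸m]%m≡n%m m≤t+d) ⟩
      (toℕ i + d) % m + m       ≡⟨ cong (_+ m) (trans (sym (toℕ-⊕ i d)) (cong toℕ eq)) ⟩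
      toℕ i + m                 ∎)

  private
    ⊕-≤ : ∀ i {a b} → a ≤ b → b < m → i ⊕ a ≡ i ⊕ b → b ≤ a
    ⊕-≤ i {a} {b} a≤b b<m eq = m∸n≡0⇒m≤n (⊕-fixed (i ⊕ a) (≤-<-trans (m∸n≤m b a) b<m) (begin
      (i ⊕ a) ⊕ (b ∸ a)   ≡⟨ ⊕-+ i a (b ∸ a) ⟨
      i ⊕ (a + (b ∸ a))   ≡⟨ cong (i ⊕_) (m+[n∸m]≡n a≤b) ⟩
      i ⊕ b               ≡⟨ eq ⟨
      i ⊕ a               ∎))
      where open ≡-Reasoning

  ⊕-injective : ∀ i {a b} → a < m → b < m → i ⊕ a ≡ i ⊕ b → a ≡ b
  ⊕-injective i {a} {b} a<m b<m eq with ≤-total a b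
  ... | inj₁ a≤b = ≤-antisym a≤b (⊕-≤ i a≤b b<m eq)
  ... | inj₂ b≤a = ≤-antisym (⊕-≤ i b≤a a<m (sym eq)) b≤a

  next-≢ : ∀ i → i ≢ next i
  next-≢ i eq = 0≢1+n (sym (⊕-fixed i (s≤s (s≤s z≤n)) (sym eq)))

  private
    V-E-adj : ∀ {i e} → IsEnd (Cycle m) i e → Adj (V i) (E e)
    V-E-adj = subst₂ (MAdj (Cycle m)) (sym (splitAt-↑ˡ m _ m)) (sym (splitAt-↑ʳ m m _))

    E-V-adj : ∀ {i e} → IsEnd (Cycle m) i e → Adj (E e) (V i)
    E-V-adj = subst₂ (MAdj (Cycle m)) (sym (splitAt-↑ʳ m m _)) (sym (splitAt-↑ˡ m _ m))

    E-E-adj : ∀ {e e′} → e ≢ e′ → ShareEnd (Cycle m) e e′ → Adj (E e) (E e′)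
    E-E-adj e≢e′ share =
      subst₂ (MAdj (Cycle m)) (sym (splitAt-↑ʳ m m _)) (sym (splitAt-↑ʳ m m _)) (e≢e′ , share)

  V-E : ∀ i → Adj (V i) (E i)
  V-E i = V-E-adj (inj₁ refl)

  Vnext-E : ∀ i → Adj (V (next i)) (E i)
  Vnext-E i = V-E-adj (inj₂ refl)

  E-V : ∀ i → Adj (E i) (V i)
  E-V i = E-V-adj (inj₁ refl)

  E-Vnext : ∀ i → Adj (E i) (V (next i))
  E-Vnext i = E-V-adj (inj₂ refl)

  E-Enext : ∀ i → Adj (E i) (E (next i))
  E-Enext i = E-E-adj (next-≢ i) (next i , inj₂ refl , inj₁ refl)

  Enext-E : ∀ i → Adj (E (next i)) (E i)
  Enext-E i = E-E-adj (≢-sym (next-≢ i)) (next i , inj₁ refl , inj₂ refl)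

  m≡n+n : m ≡ n + n
  m≡n+n = cong (n +_) (+-identityʳ n)

  n<m : n < m
  n<m = subst (n <_) (sym m≡n+n) (m<m+n n z<s)

  <n⇒<m : ∀ {j} → j < n → j < m
  <n⇒<m j<n = <-trans j<n n<m

  0<m : 0 < m
  0<m = <n⇒<m z<s

  1<n : 1 < n
  1<n = s≤s (s≤s z≤n)

  back : ℕ → ℕ
  back j = m ∸ suc j

  back<m : ∀ j → back j < m
  back<m j = ≤-<-trans (∸-monoʳ-≤ m (s≤s (z≤n {j}))) (∸-monoʳ-< z<s 0<m)

  back-last : back n₁ ≡ n
  back-last = trans (cong (_∸ n) m≡n+n) (m+n∸m≡n n n)

  n≤back : ∀ {j} → j < n → n ≤ back j
  n≤back {j} j<n = subst (_≤ back j) back-last (∸-monoʳ-≤ m j<n)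

  back-suc : ∀ {j} → suc j < m → back j ≡ suc (back (suc j))
  back-suc sj<m = +-∸-assoc 1 sj<m

  n<back : ∀ {j} → j < n₁ → n < back j
  n<back {j} j<n₁ = subst (n <_) (sym (back-suc {j} (<n⇒<m (s≤s j<n₁)))) (s≤s (n≤back (s≤s j<n₁)))

  0≢back : ∀ {j} → j < n → 0 ≢ back j
  0≢back j<n = <⇒≢ (<-≤-trans z<s (n≤back j<n))

  back-injective : ∀ {i j} → i < m → j < m → back i ≡ back j → i ≡ j
  back-injective i<m j<m = suc-injective ∘ ∸-cancelˡ-≡ i<m j<m

  back≢ : ∀ {i j} → i < m → j < m → i ≢ j → back i ≢ back j
  back≢ i<m j<m i≢j = i≢j ∘ back-injective i<m j<m

  ∑-halves : ∀ g → ∑< m g ≡ ∑< n g + ∑[ j < n ] g (back j)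
  ∑-halves g = begin
    ∑< m g                                   ≡⟨ cong (λ k → ∑< k g) m≡n+n ⟩
    ∑< (n + n) g                             ≡⟨ ∑-+ n n g ⟩
    ∑< n g + ∑[ i < n ] g (n + i)            ≡⟨ cong (∑< n g +_) (∑-reverse n (λ i → g (n + i))) ⟨
    ∑< n g + ∑[ j < n ] g (n + (n ∸ suc j))  ≡⟨ cong (∑< n g +_) (∑-cong n (λ j<n → cong g (far j<n))) ⟩
    ∑< n g + ∑[ j < n ] g (back j)           ∎
    where
    open ≡-Reasoning
    far : ∀ {j} → j < n → n + (n ∸ suc j) ≡ back j
    far {j} j<n = trans (sym (+-∸-assoc n j<n)) (cong (_∸ suc j) (sym m≡n+n))

  sum-tabulate-⊕ : ∀ z (g : Fin m → ℕ) → sum (tabulate g) ≡ ∑[ k < m ] g (z ⊕ k)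
  sum-tabulate-⊕ z g = begin
    sum (tabulate g)                      ≡⟨ sum-tabulate m g h (cong g ∘ 0⊕toℕ) ⟩
    ∑< m h                                ≡⟨ ∑-rotate m h periodic (toℕ z) ⟨
    ∑[ k < m ] h (toℕ z + k)              ≡⟨ ∑-cong m (λ {k} _ → cong g (trans (⊕-+ Fin.zero (toℕ z) k) (cong (_⊕ k) (0⊕toℕ z)))) ⟩
    ∑[ k < m ] g (z ⊕ k)                  ∎
    where
    open ≡-Reasoning
    0⊕toℕ : ∀ i → Fin.zero ⊕ toℕ i ≡ i
    0⊕toℕ i = toℕ-injective (trans (toℕ-⊕ Fin.zero (toℕ i)) (m<n⇒m%n≡m (toℕ<n i)))
    h : ℕ → ℕ
    h k = g (Fin.zero ⊕ k)
    periodic : ∀ k → h (k + m) ≡ h k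
    periodic k = cong g (trans (⊕-+ Fin.zero k m) (⊕-period _))

  size-⊕ : ∀ z (D : Distribution G) → ∣_∣ᴰ {G} D ≡ ∑[ k < m ] D (V (z ⊕ k)) + ∑[ k < m ] D (E (z ⊕ k))
  size-⊕ z D = begin
    sum (map D (allFin (m + m)))                         ≡⟨ cong sum (map-tabulate id D) ⟩
    sum (tabulate D)                                     ≡⟨ sum-tabulate-↑ m m D ⟩
    sum (tabulate (D ∘ V)) + sum (tabulate (D ∘ E))      ≡⟨ cong₂ _+_ (sum-tabulate-⊕ z (D ∘ V)) (sum-tabulate-⊕ z (D ∘ E)) ⟩
    ∑[ k < m ] D (V (z ⊕ k)) + ∑[ k < m ] D (E (z ⊕ k))  ∎
    where open ≡-Reasoning

  module Around (z : Fin m) where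

    V⊕ E⊕ : ℕ → Vertex
    V⊕ k = V (z ⊕ k)
    E⊕ k = E (z ⊕ k)

    V⊕-≢ : ∀ {a b} → a < m → b < m → a ≢ b → V⊕ a ≢ V⊕ b
    V⊕-≢ a<m b<m a≢b = a≢b ∘ ⊕-injective z a<m b<m ∘ V-injective

    E⊕-≢ : ∀ {a b} → a < m → b < m → a ≢ b → E⊕ a ≢ E⊕ b
    E⊕-≢ a<m b<m a≢b = a≢b ∘ ⊕-injective z a<m b<m ∘ E-injective

    E⊕≢V⊕ : ∀ a b → E⊕ a ≢ V⊕ b
    E⊕≢V⊕ a b = E≢V

    V⊕≢E⊕ : ∀ a b → V⊕ a ≢ E⊕ b
    V⊕≢E⊕ a b = V≢E

    forward-arm : ∀ d L (r : Vertex) → d + L ≤ n → Adj (E⊕ d) r →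
                  (∀ {j} → j < L → r ≢ E⊕ (d + j)) → (∀ {j} → j < L → r ≢ V⊕ (suc (d + j))) → Arm r L
    forward-arm d L r d+L≤n adj r≢spine r≢leaf = record
      { spine           = λ j → E⊕ (d + j)
      ; leaf            = λ j → V⊕ (suc (d + j))
      ; root-adj        = λ _ → subst (λ k → Adj (E⊕ k) r) (sym (+-identityʳ d)) adj
      ; spine-adj       = λ {j} _ → subst (λ k → Adj (E⊕ k) (E⊕ (d + j))) (sym (+-suc d j)) (Enext-E (z ⊕ (d + j)))
      ; leaf-adj        = λ {j} _ → Vnext-E (z ⊕ (d + j))
      ; spine-injective = λ i<L j<L → +-cancelˡ-≡ d _ _ ∘ ⊕-injective z (spine< i<L) (spine< j<L) ∘ E-injective
      ; leaf-injective  = λ i<L j<L → +-cancelˡ-≡ d _ _ ∘ suc-injective ∘ ⊕-injective z (leaf< i<L) (leaf< j<L) ∘ V-injective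
      ; spine≢leaf      = λ _ _ → E≢V
      ; root≢spine      = r≢spine
      ; root≢leaf       = r≢leaf
      }
      where
      leaf< : ∀ {j} → j < L → suc (d + j) < m
      leaf< j<L = ≤-<-trans (≤-trans (+-monoʳ-< d j<L) d+L≤n) n<m
      spine< : ∀ {j} → j < L → d + j < m
      spine< j<L = <-trans (n<1+n _) (leaf< j<L)

    backward-arm : ∀ L (r : Vertex) → L ≤ n → Adj (E⊕ (back 0)) r →
                   (∀ {j} → j < L → r ≢ E⊕ (back j)) → (∀ {j} → j < L → r ≢ V⊕ (back j)) → Arm r L
    backward-arm L r L≤n adj r≢spine r≢leaf = record
      { spine           = λ j → E⊕ (back j)
      ; leaf            = λ j → V⊕ (back j)
      ; root-adj        = λ _ → adj
      ; spine-adj       = λ {j} sj<L → subst (λ k → Adj (E⊕ (back (suc j))) (E⊕ k))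
                                         (sym (back-suc (<m sj<L))) (E-Enext (z ⊕ back (suc j)))
      ; leaf-adj        = λ {j} _ → V-E (z ⊕ back j)
      ; spine-injective = λ {i} {j} i<L j<L → back-injective (<m i<L) (<m j<L) ∘ ⊕-injective z (back<m i) (back<m j) ∘ E-injective
      ; leaf-injective  = λ {i} {j} i<L j<L → back-injective (<m i<L) (<m j<L) ∘ ⊕-injective z (back<m i) (back<m j) ∘ V-injective
      ; spine≢leaf      = λ _ _ → E≢V
      ; root≢spine      = r≢spine
      ; root≢leaf       = r≢leaf
      }
      where
      <m : ∀ {j} → j < L → j < m
      <m j<L = <-≤-trans j<L (≤-trans L≤n (<⇒≤ n<m))

    E⊕[back]-off-forward : ∀ d L {j} → d + L ≤ n → j < n →
                           ∀ {i} → i < L → E⊕ (back j) ≢ E⊕ (d + i) × E⊕ (back j) ≢ V⊕ (suc (d + i))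
    E⊕[back]-off-forward d L {j} d+L≤n j<n i<L =
      E⊕-≢ (back<m j) (<n⇒<m d+i<n) (>⇒≢ (<-≤-trans d+i<n (n≤back j<n))) , E≢V
      where d+i<n = <-≤-trans (+-monoʳ-< _ i<L) d+L≤n

    V⊕[back]-off-forward : ∀ d L {j} → d + L ≤ n → j < n₁ →
                           ∀ {i} → i < L → V⊕ (back j) ≢ E⊕ (d + i) × V⊕ (back j) ≢ V⊕ (suc (d + i))
    V⊕[back]-off-forward d L {j} d+L≤n j<n₁ i<L =
      V≢E , V⊕-≢ (back<m j) (≤-<-trans d+i<n n<m) (>⇒≢ (≤-<-trans d+i<n (n<back j<n₁)))
      where d+i<n = <-≤-trans (+-monoʳ-< _ i<L) d+L≤n

    -- The two arms of the target V z: along E 0, …, E (n-1) and along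
    -- E (2n-1), …, E n; their far ends both touch the antipode V n.
    vertex-forward vertex-backward : Arm (V z) n
    vertex-forward = forward-arm 0 n (V z) ≤-refl (E-V z) (λ _ → V≢E)
      (λ j<n → V⊕-≢ 0<m (≤-<-trans j<n n<m) 0≢1+n)
    vertex-backward = backward-arm n (V z) ≤-refl
      (subst (λ i → Adj (E⊕ (back 0)) (V i)) (⊕-period z) (E-Vnext (z ⊕ back 0)))
      (λ _ → V≢E) (λ {j} j<n → V⊕-≢ 0<m (back<m j) (0≢back j<n))

    module VertexTarget (D : Distribution G) where

      open Arm using (value)

      F K : Arm (V z) n
      F = vertex-forward
      K = vertex-backward

      -- The antipode V n is the far leaf of both arms: A and B leave it
      -- out, and it is counted through P instead.
      p P A B : ℕ
      p = D (V⊕ (back n₁))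
      P = p / 2
      A = 2 * weight n₁ (value F D) + D (E⊕ n₁)
      B = 2 * weight n₁ (value K D) + D (E⊕ (back n₁))

      size-≤ : ∣_∣ᴰ {G} D ≤ D (V z) + p + A + B + 2 * n₁
      size-≤ = begin
        ∣_∣ᴰ {G} D
          ≡⟨ size-⊕ z D ⟩
        ∑< m v + ∑< m e
          ≡⟨ cong₂ _+_ (∑-halves v) (∑-halves e) ⟩
        (v 0 + vF) + ∑[ j < n ] v (back j) + (∑< n e + ∑[ j < n ] e (back j))
          ≡⟨ cong₂ (λ x y → v 0 + vF + x + y) (∑-last n₁ (v ∘ back))
                   (cong₂ _+_ (∑-last n₁ e) (∑-last n₁ (e ∘ back))) ⟩
        v 0 + vF + (vK + p) + (eF + e n₁ + (eK + e (back n₁)))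
          ≡⟨ by-ring (v 0) vF vK p eF (e n₁) eK (e (back n₁)) ⟩
        v 0 + p + (eF + vF + e n₁) + (eK + vK + e (back n₁))
          ≤⟨ +-mono-≤ (+-monoʳ-≤ (v 0 + p) (+-monoˡ-≤ (e n₁) (∑+∑≤2*weight+L n₁ e (v ∘ suc))))
                      (+-monoˡ-≤ (e (back n₁)) (∑+∑≤2*weight+L n₁ (e ∘ back) (v ∘ back))) ⟩
        v 0 + p + (2 * wF + n₁ + e n₁) + (2 * wK + n₁ + e (back n₁))
          ≡⟨ by-ring′ (v 0) p wF wK n₁ (e n₁) (e (back n₁)) ⟩
        v 0 + p + A + B + 2 * n₁ ∎
        where
        open ≤-Reasoning
        v e : ℕ → ℕ
        v k = D (V⊕ k)
        e k = D (E⊕ k)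
        vF = ∑[ j < n₁ ] v (suc j)
        vK = ∑[ j < n₁ ] v (back j)
        eF = ∑< n₁ e
        eK = ∑[ j < n₁ ] e (back j)
        wF = weight n₁ (value F D)
        wK = weight n₁ (value K D)
        by-ring : ∀ v₀ vF vK p eF eₙ eK eₖ →
                 v₀ + vF + (vK + p) + (eF + eₙ + (eK + eₖ)) ≡ v₀ + p + (eF + vF + eₙ) + (eK + vK + eₖ)
        by-ring = solve-∀
        by-ring′ : ∀ v₀ p wF wK n₁ eₙ eₖ →
                 v₀ + p + (2 * wF + n₁ + eₙ) + (2 * wK + n₁ + eₖ) ≡ v₀ + p + (2 * wF + eₙ) + (2 * wK + eₖ) + 2 * n₁
        by-ring′ = solve-∀

      count : ∀ t → ∣_∣ᴰ {G} D ≡ pebbling-bound n t →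
              2 * t * 2 ^ n ≤ D (V z) + (A + B + 2 * P + 1)
      count t size = +-cancelʳ-≤ (2 * n₁) _ _ (begin
        2 * t * 2 ^ n + 2 * n₁                   ≡⟨ pebbling-bound-suc n₁ t ⟨
        pebbling-bound n t                       ≡⟨ size ⟨
        ∣_∣ᴰ {G} D                               ≤⟨ size-≤ ⟩
        D (V z) + p + A + B + 2 * n₁            ≤⟨ +-monoˡ-≤ (2 * n₁) (≤-trans (≤-reflexive (by-ring (D (V z)) p A B))
                                                      (+-monoʳ-≤ (D (V z)) (+-monoʳ-≤ (A + B) (m≤2*[m/2]+1 p)))) ⟩
        D (V z) + (A + B + (2 * P + 1)) + 2 * n₁ ≡⟨ cong (λ x → D (V z) + x + 2 * n₁) (sym (+-assoc (A + B) (2 * P) 1)) ⟩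
        D (V z) + (A + B + 2 * P + 1) + 2 * n₁  ∎)
        where
        open ≤-Reasoning
        by-ring : ∀ v₀ p A B → v₀ + p + A + B ≡ v₀ + (A + B + p)
        by-ring = solve-∀

      antipode-forward : Adj (V⊕ (back n₁)) (E⊕ n₁)
      antipode-forward = subst (λ k → Adj (V⊕ k) (E⊕ n₁)) (sym back-last) (Vnext-E (z ⊕ n₁))

      run : ∀ a → a ≤ P → Solvable G (D (V z) + ((A + a) /2^ n + (B + (P ∸ a)) /2^ n)) D (V z)
      run a a≤P = reach-solvable S.reach (solvable-≤ bound (collect-two-arms F K S.result))
        where
        open ≤-Reasoning
        b = P ∸ a
        module S = Split (split {V⊕ (back n₁)} {E⊕ n₁} {E⊕ (back n₁)}
                               antipode-forward (V-E (z ⊕ back n₁)) a b D (2*[a+[m/2∸a]]≤m p a≤P))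
        module C = Collected (collect F S.result)
        off-antipode : ∀ {j} → j < n₁ → back j ≢ back n₁
        off-antipode j<n₁ = back≢ (<n⇒<m (<-trans j<n₁ (n<1+n n₁))) (<n⇒<m (n<1+n n₁)) (<⇒≢ j<n₁)
        forward-value : (A + a) /2^ n ≤ deliver n (value F S.result)
        forward-value = deliver-far-≥ n₁ (value F D) (value F S.result) (D (E⊕ n₁)) a
          (λ {j} j<n₁ → +-mono-≤ (S.frame (E⊕≢V⊕ j (back n₁))) (/-monoˡ-≤ 2 (S.frame (V⊕-≢ (<n⇒<m (s≤s j<n₁)) (back<m n₁)
             (<⇒≢ (subst (suc j <_) (sym back-last) (s≤s j<n₁)))))))
          (≤-trans S.left (m≤m+n _ _))
        backward-value : (B + b) /2^ n ≤ deliver n (value K C.result)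
        backward-value = deliver-far-≥ n₁ (value K D) (value K C.result) (D (E⊕ (back n₁))) b
          (λ {j} j<n₁ → +-mono-≤
             (≤-trans (S.frame (E⊕≢V⊕ (back j) (back n₁))) (C.frame (E⊕[back]-off-forward 0 n ≤-refl (<-trans j<n₁ (n<1+n n₁)))))
             (/-monoˡ-≤ 2 (≤-trans (S.frame (V⊕-≢ (back<m j) (back<m n₁) (off-antipode j<n₁)))
                                   (C.frame (V⊕[back]-off-forward 0 n ≤-refl j<n₁)))))
          (≤-trans S.right (≤-trans (C.frame (E⊕[back]-off-forward 0 n ≤-refl (n<1+n n₁))) (m≤m+n _ _)))
        bound : D (V z) + ((A + a) /2^ n + (B + b) /2^ n) ≤
                S.result (V z) + (deliver n (value F S.result) + deliver n (value K C.result))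
        bound = +-mono-≤ (S.frame (V⊕-≢ 0<m (back<m n₁) (0≢back (n<1+n n₁))))
                         (+-mono-≤ forward-value backward-value)

    V-solvable : ∀ t (D : Distribution G) → ∣_∣ᴰ {G} D ≡ pebbling-bound n t → Solvable G t D (V z)
    V-solvable t D size = solvable-by-split n (D (V z)) t A B P (count t size) run
      where open VertexTarget D

    -- The two arms of the target E z: along E 1, …, E (n-1) and along
    -- E (2n-1), …, E (n+1); the antipode E n touches both far ends.
    edge-forward edge-backward : Arm (E z) n₁
    edge-forward = forward-arm 1 n₁ (E z) ≤-refl (Enext-E z)
      (λ j<n₁ → E⊕-≢ 0<m (<n⇒<m (s≤s j<n₁)) 0≢1+n) (λ {j} _ → E⊕≢V⊕ 0 (suc (1 + j)))
    edge-backward = backward-arm n₁ (E z) (n≤1+n n₁)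
      (subst (λ i → Adj (E⊕ (back 0)) (E i)) (⊕-period z) (E-Enext (z ⊕ back 0)))
      (λ {j} j<n₁ → E⊕-≢ 0<m (back<m j) (0≢back (<-trans j<n₁ (n<1+n n₁))))
      (λ {j} _ → E⊕≢V⊕ 0 (back j))

    module EdgeTarget (D : Distribution G) where

      open Arm using (value)

      F K : Arm (E z) n₁
      F = edge-forward
      K = edge-backward

      p P c A B : ℕ
      p = D (E⊕ (back n₁))
      P = p / 2
      c = D (E z) + D (V z) / 2 + D (V⊕ 1) / 2
      -- A = weight n₁ (value F D), split off its far end as in deliver-far-≥.
      A = 2 * weight n₂ (value F D) + value F D n₂
      B = 2 * weight n₂ (value K D) + value K D n₂

      size-≤ : ∣_∣ᴰ {G} D ≤ D (V z) + D (V⊕ 1) + D (E z) + p + 2 * A + 2 * B + 2 * n₁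
      size-≤ = begin
        ∣_∣ᴰ {G} D
          ≡⟨ size-⊕ z D ⟩
        ∑< m v + ∑< m e
          ≡⟨ cong₂ _+_ (∑-halves v) (∑-halves e) ⟩
        v 0 + (v 1 + vF′) + ∑[ j < n ] v (back j) + (e 0 + eF + ∑[ j < n ] e (back j))
          ≡⟨ cong₂ (λ x y → v 0 + (v 1 + vF′) + x + (e 0 + eF + y)) (∑-last n₁ (v ∘ back)) (∑-last n₁ (e ∘ back)) ⟩
        v 0 + (v 1 + vF′) + (vK + v (back n₁)) + (e 0 + eF + (eK + p))
          ≡⟨ by-ring (v 0) (v 1) vF′ vK (v (back n₁)) (e 0) eF eK p ⟩
        v 0 + v 1 + e 0 + p + (eF + (vF′ + v (back n₁))) + (eK + vK)
          ≡⟨ cong (λ x → v 0 + v 1 + e 0 + p + (eF + x) + (eK + vK)) forward-leaves ⟩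
        v 0 + v 1 + e 0 + p + (eF + vF) + (eK + vK)
          ≤⟨ +-mono-≤ (+-monoʳ-≤ (v 0 + v 1 + e 0 + p) (∑+∑≤2*weight+L n₁ (e ∘ suc) (v ∘ suc ∘ suc)))
                      (∑+∑≤2*weight+L n₁ (e ∘ back) (v ∘ back)) ⟩
        v 0 + v 1 + e 0 + p + (2 * weight n₁ (value F D) + n₁) + (2 * weight n₁ (value K D) + n₁)
          ≡⟨ cong₂ (λ x y → v 0 + v 1 + e 0 + p + (2 * x + n₁) + (2 * y + n₁))
                   (weight-last n₂ (value F D)) (weight-last n₂ (value K D)) ⟩
        v 0 + v 1 + e 0 + p + (2 * A + n₁) + (2 * B + n₁)
          ≡⟨ by-ring′ (v 0 + v 1 + e 0 + p) A B n₁ ⟩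
        v 0 + v 1 + e 0 + p + 2 * A + 2 * B + 2 * n₁ ∎
        where
        open ≤-Reasoning
        v e : ℕ → ℕ
        v k = D (V⊕ k)
        e k = D (E⊕ k)
        vF′ = ∑[ j < n₂ ] v (2 + j)
        vF  = ∑[ j < n₁ ] v (2 + j)
        vK  = ∑[ j < n₁ ] v (back j)
        eF  = ∑[ j < n₁ ] e (suc j)
        eK  = ∑[ j < n₁ ] e (back j)
        forward-leaves : vF′ + v (back n₁) ≡ vF
        forward-leaves = sym (trans (∑-last n₂ (λ j → v (2 + j))) (cong (λ k → vF′ + v k) (sym back-last)))
        by-ring : ∀ v₀ v₁ vF′ vK vₚ e₀ eF eK p →
                 v₀ + (v₁ + vF′) + (vK + vₚ) + (e₀ + eF + (eK + p)) ≡ v₀ + v₁ + e₀ + p + (eF + (vF′ + vₚ)) + (eK + vK)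
        by-ring = solve-∀
        by-ring′ : ∀ x A B n₁ → x + (2 * A + n₁) + (2 * B + n₁) ≡ x + 2 * A + 2 * B + 2 * n₁
        by-ring′ = solve-∀

      count : ∀ t → ∣_∣ᴰ {G} D ≡ pebbling-bound n t →
              2 * t * 2 ^ n₁ ≤ c + (A + B + 2 * P + 1)
      count t size = ≤-trans (2*m≤2*n+1⇒m≤n (begin
        2 * (2 * t * 2 ^ n₁)
          ≤⟨ +-cancelʳ-≤ (2 * n₁) _ _ (begin
               2 * (2 * t * 2 ^ n₁) + 2 * n₁               ≡⟨ cong (_+ 2 * n₁) (by-ring₁ t (2 ^ n₁)) ⟩
               2 * t * 2 ^ n + 2 * n₁                      ≡⟨ pebbling-bound-suc n₁ t ⟨
               pebbling-bound n t                          ≡⟨ size ⟨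
               ∣_∣ᴰ {G} D                                  ≤⟨ size-≤ ⟩
               v 0 + v 1 + e 0 + p + 2 * A + 2 * B + 2 * n₁ ∎) ⟩
        v 0 + v 1 + e 0 + p + 2 * A + 2 * B
          ≤⟨ +-monoˡ-≤ (2 * B) (+-monoˡ-≤ (2 * A) (+-mono-≤ (+-mono-≤ (+-mono-≤ (m≤2*[m/2]+1 (v 0)) (m≤2*[m/2]+1 (v 1)))
                                                                        (m≤m+n (e 0) (e 0 + 0)))
                                                              (m≤2*[m/2]+1 p))) ⟩
        2 * (v 0 / 2) + 1 + (2 * (v 1 / 2) + 1) + 2 * e 0 + (2 * P + 1) + 2 * A + 2 * B
          ≡⟨ by-ring₂ (v 0 / 2) (v 1 / 2) (e 0) P A B ⟩
        2 * (c + (A + B + P) + 1) + 1 ∎))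
        (≤-trans (≤-reflexive (+-assoc c (A + B + P) 1)) (+-monoʳ-≤ c (+-monoˡ-≤ 1 (+-monoʳ-≤ (A + B) (m≤n*m P 2)))))
        where
        open ≤-Reasoning
        v e : ℕ → ℕ
        v k = D (V⊕ k)
        e k = D (E⊕ k)
        by-ring₁ : ∀ t p → 2 * (2 * t * p) ≡ 2 * t * (2 * p)
        by-ring₁ = solve-∀
        by-ring₂ : ∀ h₀ h₁ e P A B →
                 2 * h₀ + 1 + (2 * h₁ + 1) + 2 * e + (2 * P + 1) + 2 * A + 2 * B ≡ 2 * (e + h₀ + h₁ + (A + B + P) + 1) + 1
        by-ring₂ = solve-∀

      antipode-forward : Adj (E⊕ (back n₁)) (E⊕ n₁)
      antipode-forward = subst (λ k → Adj (E⊕ k) (E⊕ n₁)) (sym back-last) (Enext-E (z ⊕ n₁))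

      antipode-backward : Adj (E⊕ (back n₁)) (E⊕ (back n₂))
      antipode-backward = subst (λ k → Adj (E⊕ (back n₁)) (E⊕ k))
        (sym (back-suc {n₂} (<n⇒<m (n<1+n n₁)))) (E-Enext (z ⊕ back n₁))

      run : ∀ a → a ≤ P → Solvable G (c + ((A + a) /2^ n₁ + (B + (P ∸ a)) /2^ n₁)) D (E z)
      run a a≤P = reach-solvable (S.reach ◅◅ R.reach) (solvable-≤ bound (collect-two-arms F K R.result))
        where
        open ≤-Reasoning
        b = P ∸ a
        module S = Split (split {E⊕ (back n₁)} {E⊕ n₁} {E⊕ (back n₂)}
                               antipode-forward antipode-backward a b D (2*[a+[m/2∸a]]≤m p a≤P))
        module R = Gather (gather {V z} {V⊕ 1} {E z} (V-E z) (Vnext-E z) (V⊕-≢ 0<m (<n⇒<m 1<n) 0≢1+n) S.result)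
        module C = Collected (collect F R.result)
        E-kept : ∀ k → k < m → k ≢ back n₁ → D (E⊕ k) ≤ R.result (E⊕ k)
        E-kept k k<m k≢ = ≤-trans (S.frame (E⊕-≢ k<m (back<m n₁) k≢)) (R.frame (E⊕≢V⊕ k 0) (E⊕≢V⊕ k 1))
        V-kept : ∀ k → k < m → 1 < k → D (V⊕ k) ≤ R.result (V⊕ k)
        V-kept k k<m 1<k = ≤-trans (S.frame (V⊕≢E⊕ k (back n₁)))
          (R.frame (V⊕-≢ k<m 0<m (>⇒≢ (<-trans z<s 1<k))) (V⊕-≢ k<m (<n⇒<m 1<n) (>⇒≢ 1<k)))
        root-value : c ≤ R.result (E z)
        root-value = ≤-trans
          (+-mono-≤ (+-mono-≤ (S.frame (E⊕-≢ 0<m (back<m n₁) (0≢back (n<1+n n₁))))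
                              (/-monoˡ-≤ 2 (S.frame (V⊕≢E⊕ 0 (back n₁)))))
                    (/-monoˡ-≤ 2 (S.frame (V⊕≢E⊕ 1 (back n₁)))))
          R.target
        forward-value : (A + a) /2^ n₁ ≤ deliver n₁ (value F R.result)
        forward-value = deliver-far-≥ n₂ (value F D) (value F R.result) (value F D n₂) a
          (λ {j} j<n₂ → +-mono-≤
             (E-kept (suc j) (<n⇒<m (s≤s (<-trans j<n₂ (n<1+n n₂))))
                (<⇒≢ (<-≤-trans (s≤s (<-trans j<n₂ (n<1+n n₂))) (n≤back (n<1+n n₁)))))
             (/-monoˡ-≤ 2 (V-kept (2 + j) (<n⇒<m (s≤s (s≤s j<n₂))) (s≤s (s≤s z≤n)))))
          (begin
            D (E⊕ n₁) + D (V⊕ n) / 2 + a           ≡⟨ xy∙z≈xz∙y (D (E⊕ n₁)) _ a ⟩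
            D (E⊕ n₁) + a + D (V⊕ n) / 2           ≤⟨ +-mono-≤ (≤-trans S.left (R.frame (E⊕≢V⊕ n₁ 0) (E⊕≢V⊕ n₁ 1)))
                                                              (/-monoˡ-≤ 2 (V-kept n n<m 1<n)) ⟩
            R.result (E⊕ n₁) + R.result (V⊕ n) / 2 ∎)
        backward-value : (B + b) /2^ n₁ ≤ deliver n₁ (value K C.result)
        backward-value = deliver-far-≥ n₂ (value K D) (value K C.result) (value K D n₂) b
          (λ {j} j<n₂ → +-mono-≤
             (≤-trans (E-kept (back j) (back<m j) (back≢ (<n⇒<m (<-trans j<n₂ (<-trans (n<1+n n₂) (n<1+n n₁))))
                                                         (<n⇒<m (n<1+n n₁)) (<⇒≢ (<-trans j<n₂ (n<1+n n₂)))))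
                      (C.frame (E⊕[back]-off-forward 1 n₁ ≤-refl (<-trans j<n₂ (<-trans (n<1+n n₂) (n<1+n n₁))))))
             (/-monoˡ-≤ 2 (≤-trans (V-kept (back j) (back<m j) (<-≤-trans 1<n (n≤back (<-trans j<n₂ (<-trans (n<1+n n₂) (n<1+n n₁))))))
                                   (C.frame (V⊕[back]-off-forward 1 n₁ ≤-refl (<-trans j<n₂ (n<1+n n₂)))))))
          (begin
            D (E⊕ (back n₂)) + D (V⊕ (back n₂)) / 2 + b  ≡⟨ xy∙z≈xz∙y (D (E⊕ (back n₂))) _ b ⟩
            D (E⊕ (back n₂)) + b + D (V⊕ (back n₂)) / 2  ≤⟨ +-mono-≤ far-spine (/-monoˡ-≤ 2 far-leaf) ⟩
            C.result (E⊕ (back n₂)) + C.result (V⊕ (back n₂)) / 2 ∎)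
          where
          n₂<n : n₂ < n
          n₂<n = <-trans (n<1+n n₂) (n<1+n n₁)
          far-spine : D (E⊕ (back n₂)) + b ≤ C.result (E⊕ (back n₂))
          far-spine = ≤-trans S.right (≤-trans (R.frame (E⊕≢V⊕ (back n₂) 0) (E⊕≢V⊕ (back n₂) 1))
                                               (C.frame (E⊕[back]-off-forward 1 n₁ ≤-refl n₂<n)))
          far-leaf : D (V⊕ (back n₂)) ≤ C.result (V⊕ (back n₂))
          far-leaf = ≤-trans (V-kept (back n₂) (back<m n₂) (<-≤-trans 1<n (n≤back n₂<n)))
                             (C.frame (V⊕[back]-off-forward 1 n₁ ≤-refl (n<1+n n₂)))
        bound : c + ((A + a) /2^ n₁ + (B + b) /2^ n₁) ≤
                R.result (E z) + (deliver n₁ (value F R.result) + deliver n₁ (value K C.result))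
        bound = +-mono-≤ root-value (+-mono-≤ forward-value backward-value)

    E-solvable : ∀ t (D : Distribution G) → ∣_∣ᴰ {G} D ≡ pebbling-bound n t → Solvable G t D (E z)
    E-solvable t D size = solvable-by-split n₁ c t A B P (count t size) run
      where open EdgeTarget D

corollary2p7 : (n t : ℕ) → 2 ≤ n → 1 ≤ t →
    PebblingAtMost (Middle (Cycle (2 * n))) t (t * 2 ^ (n + 1) + 2 * n ∸ 2)
corollary2p7 (suc (suc n₂)) t (s≤s (s≤s _)) _ = _ , ≤-refl , solvable
  where
  -- The argument does not need 1 ≤ t; it also covers t = 0.
  open MiddleCycle n₂
  solvable : Suffices G t (pebbling-bound n t)
  solvable D size r with splitAt m r in eq
  ... | inj₁ z = subst (Solvable G t D) (splitAt⁻¹-↑ˡ eq) (Around.V-solvable z t D size)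
  ... | inj₂ z = subst (Solvable G t D) (splitAt⁻¹-↑ʳ eq) (Around.E-solvable z t D size)
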